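{- For positive integers $d$ and $n$, \[ \#\{w\in S_n:\mathrm{inv}(w)=d\}=\sum(-1)^{\#\{i:\mu_i>1\}}\binom{n+m_1(\mu)-2}{m_1(\mu)}, \] where the sum is over all partitions $\mu\vdash d$ such that $\mu_1\leq n$ and all parts of $\mu$ larger than $1$ are distinct.
   Context: $\mathrm{inv}(w)=\#\{(i,j):i<j,\ w_i>w_j\}$ for a permutation $w\in S_n$ in one-line notation. $m_1(\mu)$ is the number of parts of $\mu$ equal to $1$. The binomial coefficient is the generalized one, $\binom{x}{m}=x(x-1)\cdots(x-m+1)/m!$. -}

module Defs where

open import Data.Nat as ℕ using (ℕ; zero; suc; _≤_; _<_; _≥_)
open import Data.Nat.Properties as ℕP using ()
open import Data.Nat.Combinatorics using (_C_)
open import Data.Integer as ℤ using (ℤ; +_; -[1+_]; -1ℤ)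
open import Data.Fin as Fin using (Fin)
open import Data.Fin.Properties as FinP using ()
open import Data.Vec as Vec using (Vec; []; _∷_; lookup; toList)
open import Data.List as List using (List; []; _∷_; [_]; length; filter; map; concatMap; upTo; allFin; foldr)
open import Data.Nat.ListAction using (sum)
open import Data.List.Relation.Unary.Linked using (Linked; linked?)
open import Data.List.Relation.Unary.All using (All)
import Data.List.Relation.Unary.All as All
open import Data.Product using (_×_; _,_)
open import Relation.Nullary using (Dec; _×-dec_)
open import Relation.Unary using (Decidable)
open import Relation.Binary.PropositionalEquality using (_≡_)
import Data.List.Relation.Unary.Unique.DecPropositional

-- Permutations of {0,…,n-1} in one-line notation: vectors w = (w_0,…,w_{n-1})
-- over Fin n whose entries are pairwise distinct (injective, hence bijective).

module UFin {n : ℕ} = Data.List.Relation.Unary.Unique.DecPropositional (FinP._≟_ {n})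

IsPerm : {n : ℕ} → Vec (Fin n) n → Set
IsPerm w = UFin.Unique (toList w)

isPerm? : {n : ℕ} → Decidable (IsPerm {n})
isPerm? w = UFin.unique? (toList w)

vecsOver : {B : Set} → List B → (k : ℕ) → List (Vec B k)
vecsOver A zero    = [ [] ]
vecsOver A (suc k) = concatMap (λ a → map (a ∷_) (vecsOver A k)) A

allPairs : (n : ℕ) → List (Fin n × Fin n)
allPairs n = concatMap (λ i → map (i ,_) (allFin n)) (allFin n)

inv : {n : ℕ} → Vec (Fin n) n → ℕ
inv {n} w = length (filter (λ { (i , j) → (i Fin.<? j) ×-dec (lookup w j Fin.<? lookup w i) }) (allPairs n))

numPermsWithInv : (n d : ℕ) → ℕ
numPermsWithInv n d =
  length (filter (λ w → isPerm? w ×-dec (inv w ℕ.≟ d)) (vecsOver (allFin n) n))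

IsPartitionOf : ℕ → List ℕ → Set
IsPartitionOf d μ = Linked _≥_ μ × All (1 ≤_) μ × (sum μ ≡ d)

isPartitionOf? : (d : ℕ) → Decidable (IsPartitionOf d)
isPartitionOf? d μ = linked? (λ x y → y ℕ.≤? x) μ ×-dec All.all? (1 ℕ.≤?_) μ ×-dec (sum μ ℕ.≟ d)

-- finite candidate set containing every partition of d exactly once:
-- all lists of length ≤ d with entries in {1,…,d}
candidates : ℕ → List (List ℕ)
candidates d = concatMap (λ k → map Vec.toList (vecsOver (map suc (upTo d)) k)) (upTo (suc d))

-- μ_1, the largest part (0 for the empty partition)
μ₁ : List ℕ → ℕ
μ₁ []      = 0
μ₁ (x ∷ _) = x

m₁ : List ℕ → ℕ
m₁ μ = length (filter (ℕ._≟ 1) μ)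

bigParts : List ℕ → List ℕ
bigParts μ = filter (1 ℕ.<?_) μ

module Uℕ = Data.List.Relation.Unary.Unique.DecPropositional ℕ._≟_

InRange : ℕ → ℕ → List ℕ → Set
InRange n d μ = IsPartitionOf d μ × μ₁ μ ≤ n × Uℕ.Unique (bigParts μ)

inRange? : (n d : ℕ) → Decidable (InRange n d)
inRange? n d μ = isPartitionOf? d μ ×-dec (μ₁ μ ℕ.≤? n) ×-dec Uℕ.unique? (bigParts μ)

-- Generalized binomial coefficient binom(x, m) = x(x-1)…(x-m+1)/m! for x ∈ ℤ:
-- for x = k ≥ 0 it is k C m; for x = -(k+1) it equals (-1)^m (k+m C m).

binomℤ : ℤ → ℕ → ℤ
binomℤ (+ k)     m = + (k C m)
binomℤ -[1+ k ]  m = (-1ℤ ℤ.^ m) ℤ.* + ((k ℕ.+ m) C m)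

sumℤ : List ℤ → ℤ
sumℤ = foldr ℤ._+_ (+ 0)

term : ℕ → List ℕ → ℤ
term n μ = (-1ℤ ℤ.^ length (bigParts μ)) ℤ.* binomℤ ((+ n ℤ.+ + m₁ μ) ℤ.- + 2) (m₁ μ)

rhs : ℕ → ℕ → ℤ
rhs n d = sumℤ (map (term n) (filter (inRange? n d) (candidates d)))

module Submission where

-- Integer sequences X : ℕ → ℤ are read as power series Σ_d X(d) q^d, and n = k + 1.
-- * Left side: classifying a permutation of Fin (n+1) by its first entry a, which
--   contributes exactly a inversions, gives the Lehmer recurrence
--   I_{n+1} = (1 + q + ⋯ + q^n) · I_n with I_1 = 1 (perms-rec).
-- * Right side: a partition in the range is determined by its set S ⊆ {2, …, k+1} of
--   parts > 1 and its number m of ones (range↭canonical), so the sum is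
--   Σ_S (-1)^|S| q^(ΣS) · Σ_m binom(k+m-1, m) q^m = ∏_{j=2}^{k+1} (1 - q^j) / (1 - q)^k
--   (qprod-expand, rhs-expand).
-- * Since 1 + q + ⋯ + q^(j-1) = (1 - q^j)/(1 - q), both sides solve Y_0 = 1,
--   Y_{k+1} = (1 + ⋯ + q^(k+1)) · Y_k (window-recurrence), which gives the theorem.

open import Defs

open import Data.Nat as ℕ using (ℕ; zero; suc; _≤_; _<_; _≥_; _>_; _∸_; z≤n; s≤s)
import Data.Nat.Properties as ℕP
open import Data.Nat.ListAction using (sum)
import Data.Nat.ListAction.Properties as SumP
open import Data.Nat.Combinatorics using (_C_; k>n⇒nCk≡0; nCk+nC[k+1]≡[n+1]C[k+1])
open import Data.Integer as ℤ using (ℤ; +_; -1ℤ; _+_; _-_; _*_; -_)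
import Data.Integer.Properties as ℤP
open import Data.Integer.Solver using (module +-*-Solver)
open import Data.Fin as Fin using (Fin; toℕ; punchIn; punchOut)
import Data.Fin.Properties as FinP
open import Data.Vec as Vec using (Vec; []; _∷_; lookup; toList; fromList)
import Data.Vec.Properties as VecP
open import Data.Vec.Membership.Propositional.Properties using (∈-lookup; ∈-toList⁺)
open import Data.List as List
  using (List; []; _∷_; _++_; _∷ʳ_; length; map; filter; concatMap; applyUpTo; allFin; replicate; upTo)
import Data.List.Properties as LP
open import Data.List.Membership.Propositional using (_∈_)
open import Data.List.Membership.Propositional.Properties
  using (∈-allFin; ∈-map⁺; ∈-map⁻; ∈-++⁺ˡ; ∈-++⁺ʳ; ∈-++⁻; ∈-filter⁺; ∈-filter⁻; ∈-concatMap⁺; ∈-concatMap⁻;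
         ∈-upTo⁺)
open import Data.List.Relation.Unary.Any using (here; there)
import Data.List.Relation.Unary.Any as Any
open import Data.List.Membership.Propositional.Properties.WithK using (unique∧set⇒bag)
import Data.List.Membership.DecPropositional as DecMembership
open import Data.List.Relation.Unary.All as All using (All; []; _∷_)
import Data.List.Relation.Unary.All.Properties as AllP
open import Data.List.Relation.Unary.AllPairs as AllPairs using (AllPairs; []; _∷_)
import Data.List.Relation.Unary.AllPairs.Properties as AllPairsP
open import Data.List.Relation.Unary.Linked as Linked using (Linked; []; [-]; _∷_)
import Data.List.Relation.Unary.Linked.Properties as LinkedP
open import Data.List.Relation.Unary.Unique.Propositional using (Unique)
import Data.List.Relation.Unary.Unique.Propositional.Properties as UniqueP
open import Data.List.Relation.Binary.BagAndSetEquality using (∼bag⇒↭)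
open import Data.List.Relation.Binary.Permutation.Propositional using (_↭_; ↭⇒↭ₛ)
import Data.List.Relation.Binary.Permutation.Propositional.Properties as ↭P
open import Data.List.Relation.Binary.Permutation.Setoid.Properties using (foldr-commMonoid)
open import Data.Product using (_×_; _,_; proj₁; proj₂)
open import Data.Sum using (inj₁; inj₂)
open import Data.Empty using (⊥-elim)
open import Relation.Nullary using (¬_; yes; no; does; _×-dec_; ¬?)
open import Relation.Unary using (Decidable)
open import Relation.Binary.PropositionalEquality
open import Data.Bool using (true; false)
open import Function using (_∘_; mk⇔)

open +-*-Solver using (solve; con; _:+_; _:*_; _:-_; _:=_)

count : {A : Set} {P : A → Set} → Decidable P → List A → ℕ
count P? xs = length (filter P? xs)

count-≐ : {A : Set} {P Q : A → Set} (P? : Decidable P) (Q? : Decidable Q) →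
  (∀ {x} → P x → Q x) → (∀ {x} → Q x → P x) → ∀ xs → count P? xs ≡ count Q? xs
count-≐ P? Q? P⇒Q Q⇒P xs = cong length (LP.filter-≐ P? Q? (P⇒Q , Q⇒P) xs)

count-none : {A : Set} {P : A → Set} (P? : Decidable P) → (∀ x → ¬ P x) → ∀ xs → count P? xs ≡ 0
count-none P? ¬P xs = cong length (LP.filter-none P? (All.universal ¬P xs))

count-map : {A B : Set} {P : B → Set} (P? : Decidable P) (f : A → B) →
  ∀ xs → count P? (map f xs) ≡ count (P? ∘ f) xs
count-map P? f []       = refl
count-map P? f (x ∷ xs) with does (P? (f x))
... | true  = cong suc (count-map P? f xs)
... | false = count-map P? f xs

count-filter : {A : Set} {P Q : A → Set} (P? : Decidable P) (Q? : Decidable Q) →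
  ∀ xs → count P? (filter Q? xs) ≡ count (λ x → Q? x ×-dec P? x) xs
count-filter P? Q? []       = refl
count-filter P? Q? (x ∷ xs) with does (Q? x)
... | false = count-filter P? Q? xs
... | true with does (P? x)
...   | true  = cong suc (count-filter P? Q? xs)
...   | false = count-filter P? Q? xs

count-++ : {A : Set} {P : A → Set} (P? : Decidable P) →
  ∀ xs ys → count P? (xs ++ ys) ≡ count P? xs ℕ.+ count P? ys
count-++ P? xs ys = trans (cong length (LP.filter-++ P? xs ys)) (LP.length-++ (filter P? xs))

count-concatMap : {A B : Set} {P : B → Set} (P? : Decidable P) (f : A → List B) →
  ∀ xs → count P? (concatMap f xs) ≡ sum (map (count P? ∘ f) xs)
count-concatMap P? f []       = refl
count-concatMap P? f (x ∷ xs) =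
  trans (count-++ P? (f x) (concatMap f xs)) (cong (count P? (f x) ℕ.+_) (count-concatMap P? f xs))

count-↭ : {A : Set} {P : A → Set} (P? : Decidable P) {xs ys : List A} →
  xs ↭ ys → count P? xs ≡ count P? ys
count-↭ P? xs↭ys = ↭P.↭-length (↭P.filter-↭ P? xs↭ys)

filter-map : {A B : Set} {P : B → Set} (P? : Decidable P) (f : A → B) →
  ∀ xs → filter P? (map f xs) ≡ map f (filter (P? ∘ f) xs)
filter-map P? f []       = refl
filter-map P? f (x ∷ xs) with does (P? (f x))
... | true  = cong (f x ∷_) (filter-map P? f xs)
... | false = filter-map P? f xs

sumℤ-++ : ∀ xs ys → sumℤ (xs ++ ys) ≡ sumℤ xs + sumℤ ys
sumℤ-++ []       ys = sym (ℤP.+-identityˡ _)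
sumℤ-++ (x ∷ xs) ys = trans (cong (_+_ x) (sumℤ-++ xs ys)) (sym (ℤP.+-assoc x _ _))

sumℤ-↭ : ∀ {xs ys} → xs ↭ ys → sumℤ xs ≡ sumℤ ys
sumℤ-↭ xs↭ys = foldr-commMonoid (setoid ℤ) ℤP.+-0-isCommutativeMonoid (↭⇒↭ₛ xs↭ys)

module _ {A : Set} where

  sumℤ-cong : (f g : A → ℤ) → (∀ x → f x ≡ g x) → ∀ xs → sumℤ (map f xs) ≡ sumℤ (map g xs)
  sumℤ-cong f g f≗g xs = cong sumℤ (LP.map-cong f≗g xs)

  sumℤ-neg : (f : A → ℤ) → ∀ xs → sumℤ (map (λ x → - f x) xs) ≡ - sumℤ (map f xs)
  sumℤ-neg f []       = refl
  sumℤ-neg f (x ∷ xs) = trans (cong (_+_ (- f x)) (sumℤ-neg f xs)) (sym (ℤP.neg-distrib-+ (f x) _))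

  sumℤ-zero : (f : A → ℤ) → (∀ x → f x ≡ + 0) → ∀ xs → sumℤ (map f xs) ≡ + 0
  sumℤ-zero f f≡0 []       = refl
  sumℤ-zero f f≡0 (x ∷ xs) = cong₂ _+_ (f≡0 x) (sumℤ-zero f f≡0 xs)

  sumℤ-cast : (f : A → ℕ) → ∀ xs → + sum (map f xs) ≡ sumℤ (map (+_ ∘ f) xs)
  sumℤ-cast f []       = refl
  sumℤ-cast f (x ∷ xs) = cong (_+_ (+ f x)) (sumℤ-cast f xs)

sumℤ-filter : {A : Set} {P : A → Set} (P? : Decidable P) (f g : A → ℤ) → ∀ xs →
  (∀ {x} → x ∈ xs → P x → f x ≡ g x) → (∀ {x} → x ∈ xs → ¬ P x → g x ≡ + 0) →
  sumℤ (map f (filter P? xs)) ≡ sumℤ (map g xs)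
sumℤ-filter P? f g []       _      _      = refl
sumℤ-filter P? f g (x ∷ xs) accept reject with P? x
... | yes px = cong₂ _+_ (accept (here refl) px) (sumℤ-filter P? f g xs (accept ∘ there) (reject ∘ there))
... | no ¬px = trans (sumℤ-filter P? f g xs (accept ∘ there) (reject ∘ there))
                     (sym (trans (cong (_+ sumℤ (map g xs)) (reject (here refl) ¬px)) (ℤP.+-identityˡ _)))

unique-map-on : {A B : Set} (f : A → B) {xs : List A} → Unique xs →
  (∀ {x y} → x ∈ xs → y ∈ xs → f x ≡ f y → x ≡ y) → Unique (map f xs)
unique-map-on f []         _   = []
unique-map-on f (x∉ ∷ uxs) inj =
  AllP.map⁺ (All.tabulate (λ y∈ fx≡fy → All.lookup x∉ y∈ (inj (here refl) (there y∈) fx≡fy)))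
  ∷ unique-map-on f uxs (λ x∈ y∈ → inj (there x∈) (there y∈))

unique-concatMap : {A B : Set} (f : A → List B) {L : List A} → Unique L → (∀ a → Unique (f a)) →
  (∀ {a b x} → x ∈ f a → x ∈ f b → a ≡ b) → Unique (concatMap f L)
unique-concatMap f []            _     _     = []
unique-concatMap f {a ∷ L} (a∉ ∷ uL) ublock same =
  UniqueP.++⁺ (ublock a) (unique-concatMap f uL ublock same) disjoint
  where
  disjoint : ∀ {x} → ¬ (x ∈ f a × x ∈ concatMap f L)
  disjoint (x∈a , x∈L) = All.lookupWith (λ a≢b x∈b → a≢b (same x∈a x∈b)) a∉ (∈-concatMap⁻ f {xs = L} x∈L)

-- Sequences as power series.

-- A sequence X : ℕ → ℤ is read as the power series Σ_d X(d) q^d.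
Seq : Set
Seq = ℕ → ℤ

-- shift s X is q^s · X, i.e. d ↦ X(d - s), vanishing below degree s.
shift : ℕ → Seq → Seq
shift zero    X d       = X d
shift (suc s) X zero    = + 0
shift (suc s) X (suc d) = shift s X d

-- prefix X is X / (1 - q), i.e. the partial sums d ↦ X 0 + … + X d.
prefix : Seq → Seq
prefix X zero    = X 0
prefix X (suc d) = prefix X d + X (suc d)

-- window j X is (1 + q + … + q^(j-1)) · X.
window : ℕ → Seq → Seq
window j X d = sumℤ (applyUpTo (λ t → shift t X d) j)

-- oneMinusQ m X is (1 - q^m) · X.
oneMinusQ : ℕ → Seq → Seq
oneMinusQ m X d = X d - shift m X d

shift-cong : ∀ s {X Y} → X ≗ Y → shift s X ≗ shift s Y
shift-cong zero    X≗Y d       = X≗Y d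
shift-cong (suc s) X≗Y zero    = refl
shift-cong (suc s) X≗Y (suc d) = shift-cong s X≗Y d

shift-≤ : ∀ s X {d} → s ≤ d → shift s X d ≡ X (d ∸ s)
shift-≤ zero    X _         = refl
shift-≤ (suc s) X (s≤s s≤d) = shift-≤ s X s≤d

shift-> : ∀ s X {d} → d < s → shift s X d ≡ + 0
shift-> (suc s) X {zero}  _         = refl
shift-> (suc s) X {suc d} (s≤s d<s) = shift-> s X d<s

shift-+ : ∀ a b X → shift (a ℕ.+ b) X ≗ shift a (shift b X)
shift-+ zero    b X d       = refl
shift-+ (suc a) b X zero    = refl
shift-+ (suc a) b X (suc d) = shift-+ a b X d

shift-Σ : {A : Set} (c : A → ℤ) (F : A → Seq) (xs : List A) → ∀ s d →
  shift s (λ e → sumℤ (map (λ x → c x * F x e) xs)) d ≡ sumℤ (map (λ x → c x * shift s (F x) d) xs)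
shift-Σ c F xs zero    d       = refl
shift-Σ c F xs (suc s) zero    = sym (sumℤ-zero _ (λ x → ℤP.*-zeroʳ (c x)) xs)
shift-Σ c F xs (suc s) (suc d) = shift-Σ c F xs s d

prefix-cong : ∀ {X Y} → X ≗ Y → prefix X ≗ prefix Y
prefix-cong X≗Y zero    = X≗Y 0
prefix-cong X≗Y (suc d) = cong₂ _+_ (prefix-cong X≗Y d) (X≗Y (suc d))

prefix-− : ∀ X Y d → prefix (λ e → X e - Y e) d ≡ prefix X d - prefix Y d
prefix-− X Y zero    = refl
prefix-− X Y (suc d) = trans (cong (_+ (X (suc d) - Y (suc d))) (prefix-− X Y d))
  (solve 4 (λ a b x y → (a :- b) :+ (x :- y) := (a :+ x) :- (b :+ y)) refl
     (prefix X d) (prefix Y d) (X (suc d)) (Y (suc d)))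

prefix-shift-suc : ∀ s X d → prefix (shift (suc s) X) (suc d) ≡ prefix (shift s X) d
prefix-shift-suc s X zero    = ℤP.+-identityˡ (shift s X 0)
prefix-shift-suc s X (suc d) = cong (_+ shift s X (suc d)) (prefix-shift-suc s X d)

prefix-shift : ∀ s X → prefix (shift s X) ≗ shift s (prefix X)
prefix-shift zero    X d       = refl
prefix-shift (suc s) X zero    = refl
prefix-shift (suc s) X (suc d) = trans (prefix-shift-suc s X d) (prefix-shift s X d)

shift-prefix-step : ∀ j X d → shift j (prefix X) d ≡ shift (suc j) (prefix X) d + shift j X d
shift-prefix-step zero    X zero    = sym (ℤP.+-identityˡ (X 0))
shift-prefix-step zero    X (suc d) = refl
shift-prefix-step (suc j) X zero    = refl
shift-prefix-step (suc j) X (suc d) = shift-prefix-step j X d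

window-prefix : ∀ j X → window j X ≗ oneMinusQ j (prefix X)
window-prefix zero    X d = sym (ℤP.+-inverseʳ (prefix X d))
window-prefix (suc j) X d = begin
  sumℤ (applyUpTo f (suc j))              ≡⟨ cong sumℤ (sym (LP.applyUpTo-∷ʳ f j)) ⟩
  sumℤ (applyUpTo f j ∷ʳ f j)              ≡⟨ sumℤ-++ (applyUpTo f j) (f j ∷ []) ⟩
  window j X d + (f j + + 0)              ≡⟨ cong₂ _+_ (window-prefix j X d) (ℤP.+-identityʳ (f j)) ⟩
  (P d - shift j P d) + f j               ≡⟨ cong (λ z → (P d - z) + f j) (shift-prefix-step j X d) ⟩
  (P d - (shift (suc j) P d + f j)) + f j ≡⟨ solve 3 (λ p a b → (p :- (a :+ b)) :+ b := p :- a) refl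
                                                (P d) (shift (suc j) P d) (f j) ⟩
  P d - shift (suc j) P d ∎
  where
  open ≡-Reasoning
  P = prefix X
  f : ℕ → ℤ
  f t = shift t X d

oneMinusQ-cong : ∀ m {X Y} → X ≗ Y → oneMinusQ m X ≗ oneMinusQ m Y
oneMinusQ-cong m X≗Y d = cong₂ _-_ (X≗Y d) (shift-cong m X≗Y d)

-- qprod k X is (1 - q^2)(1 - q^3)⋯(1 - q^(k+1)) · X.
qprod : ℕ → Seq → Seq
qprod zero    X = X
qprod (suc k) X = oneMinusQ (suc (suc k)) (qprod k X)

qprod-cong : ∀ k {X Y} → X ≗ Y → qprod k X ≗ qprod k Y
qprod-cong zero    X≗Y d = X≗Y d
qprod-cong (suc k) X≗Y d = cong₂ _-_ (qprod-cong k X≗Y d) (shift-cong (suc (suc k)) (qprod-cong k X≗Y) d)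

qprod-prefix : ∀ k X → qprod k (prefix X) ≗ prefix (qprod k X)
qprod-prefix zero    X d = refl
qprod-prefix (suc k) X d = begin
  Q d - shift m Q d                           ≡⟨ cong₂ _-_ (qprod-prefix k X d) (shift-cong m (qprod-prefix k X) d) ⟩
  prefix Y d - shift m (prefix Y) d           ≡⟨ cong (_-_ (prefix Y d)) (sym (prefix-shift m Y d)) ⟩
  prefix Y d - prefix (shift m Y) d           ≡⟨ sym (prefix-− Y (shift m Y) d) ⟩
  prefix (oneMinusQ m Y) d ∎
  where
  open ≡-Reasoning
  m = suc (suc k)
  Q = qprod k (prefix X)
  Y = qprod k X

-- binomTerm k m = binom(k + m - 1, m), the binomial coefficient of the summand for n = k + 1.
-- As a series it is 1 / (1 - q)^k.
binomTerm : ℕ → Seq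
binomTerm k m = binomℤ ((+ suc k + + m) - + 2) m

binomTerm-0 : ∀ k → binomTerm k 0 ≡ + 1
binomTerm-0 zero    = refl
binomTerm-0 (suc k) = refl

binomTerm-unit : ∀ m → binomTerm 0 (suc m) ≡ + 0
binomTerm-unit m = cong +_ (k>n⇒nCk≡0 (ℕP.n<1+n m))

binomTerm-pascal : ∀ k m → binomTerm (suc k) (suc m) ≡ binomTerm (suc k) m + binomTerm k (suc m)
binomTerm-pascal k m = begin
  binomTerm (suc k) (suc m)                ≡⟨ cong (λ z → binomℤ (+ suc (suc z) - + 2) (suc m)) (ℕP.+-suc k m) ⟩
  + (suc (k ℕ.+ m) C suc m)                ≡⟨ cong +_ (sym (nCk+nC[k+1]≡[n+1]C[k+1] (k ℕ.+ m) m)) ⟩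
  + ((k ℕ.+ m) C m) + + ((k ℕ.+ m) C suc m) ≡⟨ cong (_+_ (+ ((k ℕ.+ m) C m))) (sym lower) ⟩
  binomTerm (suc k) m + binomTerm k (suc m) ∎
  where
  open ≡-Reasoning
  lower : binomTerm k (suc m) ≡ + ((k ℕ.+ m) C suc m)
  lower = cong (λ z → binomℤ (+ suc z - + 2) (suc m)) (ℕP.+-suc k m)

binomTerm-prefix : ∀ k → binomTerm (suc k) ≗ prefix (binomTerm k)
binomTerm-prefix k zero    = trans (binomTerm-0 (suc k)) (sym (binomTerm-0 k))
binomTerm-prefix k (suc m) = trans (binomTerm-pascal k m) (cong (_+ binomTerm k (suc m)) (binomTerm-prefix k m))

window-recurrence : (Y : ℕ → Seq) → Y 0 ≗ binomTerm 0 →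
  (∀ k → Y (suc k) ≗ window (suc (suc k)) (Y k)) → ∀ k → Y k ≗ qprod k (binomTerm k)
window-recurrence Y Y₀ Yₛ zero    d = Y₀ d
window-recurrence Y Y₀ Yₛ (suc k) d = begin
  Y (suc k) d                          ≡⟨ Yₛ k d ⟩
  window m (Y k) d                     ≡⟨ window-prefix m (Y k) d ⟩
  oneMinusQ m (prefix (Y k)) d         ≡⟨ oneMinusQ-cong m (prefix-cong (window-recurrence Y Y₀ Yₛ k)) d ⟩
  oneMinusQ m (prefix (qprod k B)) d   ≡⟨ oneMinusQ-cong m (λ e → sym (qprod-prefix k B e)) d ⟩
  oneMinusQ m (qprod k (prefix B)) d   ≡⟨ oneMinusQ-cong m (qprod-cong k (λ e → sym (binomTerm-prefix k e))) d ⟩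
  qprod (suc k) (binomTerm (suc k)) d ∎
  where
  open ≡-Reasoning
  m = suc (suc k)
  B = binomTerm k

-- The inversion generating function of S_n.

vecsOver-map : {A B : Set} (g : A → B) (L : List A) → ∀ k → vecsOver (map g L) k ≡ map (Vec.map g) (vecsOver L k)
vecsOver-map g L zero    = refl
vecsOver-map g L (suc k) = begin
  concatMap (λ b → map (b ∷_) (vecsOver (map g L) k)) (map g L)
    ≡⟨ cong (λ V → concatMap (λ b → map (b ∷_) V) (map g L)) (vecsOver-map g L k) ⟩
  concatMap (λ b → map (b ∷_) (map (Vec.map g) (vecsOver L k))) (map g L)
    ≡⟨ LP.concatMap-map (λ b → map (b ∷_) (map (Vec.map g) (vecsOver L k))) g L ⟩
  concatMap (λ a → map (g a ∷_) (map (Vec.map g) (vecsOver L k))) L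
    ≡⟨ LP.concatMap-cong (λ a → trans (sym (LP.map-∘ (vecsOver L k))) (LP.map-∘ (vecsOver L k))) L ⟩
  concatMap (λ a → map (Vec.map g) (map (a ∷_) (vecsOver L k))) L
    ≡⟨ sym (LP.map-concatMap (Vec.map g) (λ a → map (a ∷_) (vecsOver L k)) L) ⟩
  map (Vec.map g) (vecsOver L (suc k)) ∎
  where open ≡-Reasoning

module _ {A : Set} {P : A → Set} (P? : Decidable P) where

  allEntries? : ∀ {k} → Decidable (λ (v : Vec A k) → All P (toList v))
  allEntries? v = All.all? P? (toList v)

  private
    filter-accepted : ∀ {k b} → P b → (V : List (Vec A k)) →
      filter allEntries? (map (b ∷_) V) ≡ map (b ∷_) (filter allEntries? V)
    filter-accepted {b = b} pb V = trans (filter-map allEntries? (b ∷_) V)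
      (cong (map (b ∷_)) (LP.filter-≐ _ allEntries? (All.tail , (pb ∷_)) V))

    filter-rejected : ∀ {k b} → ¬ P b → (V : List (Vec A k)) → filter allEntries? (map (b ∷_) V) ≡ []
    filter-rejected {b = b} ¬pb V = trans (filter-map allEntries? (b ∷_) V)
      (cong (map (b ∷_)) (LP.filter-none _ (All.universal (λ _ → ¬pb ∘ All.head) V)))

    filter-blocks : ∀ {k} (V : List (Vec A k)) L →
      filter allEntries? (concatMap (λ b → map (b ∷_) V) L)
      ≡ concatMap (λ b → map (b ∷_) (filter allEntries? V)) (filter P? L)
    filter-blocks V []      = refl
    filter-blocks V (b ∷ L) with P? b
    ... | yes pb = trans (LP.filter-++ allEntries? (map (b ∷_) V) _)
                         (cong₂ _++_ (filter-accepted pb V) (filter-blocks V L))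
    ... | no ¬pb = trans (LP.filter-++ allEntries? (map (b ∷_) V) _)
                         (cong₂ _++_ (filter-rejected ¬pb V) (filter-blocks V L))

  vecsOver-filter : ∀ L k → filter allEntries? (vecsOver L k) ≡ vecsOver (filter P? L) k
  vecsOver-filter L zero    = refl
  vecsOver-filter L (suc k) = trans (filter-blocks (vecsOver L k) L)
    (cong (λ V → concatMap (λ b → map (b ∷_) V) (filter P? L)) (vecsOver-filter L k))

distinctFrom? : ∀ {n} (a : Fin n) → Decidable (λ b → ¬ a ≡ b)
distinctFrom? a b = ¬? (a FinP.≟ b)

allFin-punchIn : ∀ n (a : Fin (suc n)) → filter (distinctFrom? a) (allFin (suc n)) ≡ map (punchIn a) (allFin n)
allFin-punchIn n Fin.zero = begin
  filter (distinctFrom? Fin.zero) (List.tabulate Fin.suc) ≡⟨ LP.filter-all _ (AllP.tabulate⁺ (λ _ ())) ⟩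
  List.tabulate Fin.suc                                   ≡⟨ sym (LP.map-tabulate (λ i → i) Fin.suc) ⟩
  map Fin.suc (allFin n) ∎
  where open ≡-Reasoning
allFin-punchIn (suc n) (Fin.suc a) = cong (Fin.zero ∷_) (begin
  filter (distinctFrom? (Fin.suc a)) (List.tabulate Fin.suc)
    ≡⟨ cong (filter (distinctFrom? (Fin.suc a))) (sym (LP.map-tabulate (λ i → i) Fin.suc)) ⟩
  filter (distinctFrom? (Fin.suc a)) (map Fin.suc (allFin (suc n)))
    ≡⟨ filter-map (distinctFrom? (Fin.suc a)) Fin.suc (allFin (suc n)) ⟩
  map Fin.suc (filter (distinctFrom? (Fin.suc a) ∘ Fin.suc) (allFin (suc n)))
    ≡⟨ cong (map Fin.suc) (LP.filter-≐ (distinctFrom? (Fin.suc a) ∘ Fin.suc) (distinctFrom? a)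
                                          ((_∘ cong Fin.suc) , (_∘ FinP.suc-injective)) (allFin (suc n))) ⟩
  map Fin.suc (filter (distinctFrom? a) (allFin (suc n)))
    ≡⟨ cong (map Fin.suc) (allFin-punchIn n a) ⟩
  map Fin.suc (map (punchIn a) (allFin n))
    ≡⟨ sym (LP.map-∘ (allFin n)) ⟩
  map (punchIn (Fin.suc a) ∘ Fin.suc) (allFin n)
    ≡⟨ LP.map-∘ (allFin n) ⟩
  map (punchIn (Fin.suc a)) (map Fin.suc (allFin n))
    ≡⟨ cong (map (punchIn (Fin.suc a))) (LP.map-tabulate (λ i → i) Fin.suc) ⟩
  map (punchIn (Fin.suc a)) (List.tabulate Fin.suc) ∎)
  where open ≡-Reasoning

punchIn-<-⇔ : ∀ {n} (a : Fin (suc n)) (y : Fin n) →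
  (toℕ (punchIn a y) < toℕ a → toℕ y < toℕ a) × (toℕ y < toℕ a → toℕ (punchIn a y) < toℕ a)
punchIn-<-⇔ Fin.zero       y           = (λ ()) , (λ ())
punchIn-<-⇔ (Fin.suc a) Fin.zero    = (λ _ → s≤s z≤n) , (λ _ → s≤s z≤n)
punchIn-<-⇔ (Fin.suc a) (Fin.suc y) = (λ { (s≤s p) → s≤s (proj₁ (punchIn-<-⇔ a y) p) }) ,
                                      (λ { (s≤s p) → s≤s (proj₂ (punchIn-<-⇔ a y) p) })

punchIn-<-mono : ∀ {n} (a : Fin (suc n)) {y z : Fin n} →
  toℕ y < toℕ z → toℕ (punchIn a y) < toℕ (punchIn a z)
punchIn-<-mono a {y} {z} y<z = ℕP.≰⇒> (λ pz≤py → ℕP.<⇒≱ y<z (FinP.punchIn-cancel-≤ a z y pz≤py))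

punchIn-<-cancel : ∀ {n} (a : Fin (suc n)) {y z : Fin n} →
  toℕ (punchIn a y) < toℕ (punchIn a z) → toℕ y < toℕ z
punchIn-<-cancel a {y} {z} py<pz = ℕP.≰⇒> (λ z≤y → ℕP.<⇒≱ py<pz (FinP.punchIn-mono-≤ a z y z≤y))

count-allFin-suc : ∀ {k} {P : Fin (suc k) → Set} (P? : Decidable P) →
  count P? (allFin (suc k)) ≡ count P? (Fin.zero ∷ []) ℕ.+ count (P? ∘ Fin.suc) (allFin k)
count-allFin-suc {k} P? = trans (count-++ P? (Fin.zero ∷ []) (List.tabulate Fin.suc))
  (cong (count P? (Fin.zero ∷ []) ℕ.+_)
    (trans (cong (count P?) (sym (LP.map-tabulate (λ i → i) Fin.suc))) (count-map P? Fin.suc (allFin k))))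

count-below : ∀ n t → t ≤ n → count (λ (y : Fin n) → toℕ y ℕP.<? t) (allFin n) ≡ t
count-below n       zero    _         = count-none _ (λ _ ()) (allFin n)
count-below (suc n) (suc t) (s≤s t≤n) = begin
  count (λ y → toℕ y ℕP.<? suc t) (allFin (suc n))              ≡⟨ count-allFin-suc {n} (λ y → toℕ y ℕP.<? suc t) ⟩
  suc (count (λ y → suc (toℕ y) ℕP.<? suc t) (allFin n))         ≡⟨ cong suc (count-≐ _ _ ℕP.≤-pred s≤s (allFin n)) ⟩
  suc (count (λ y → toℕ y ℕP.<? t) (allFin n))                   ≡⟨ cong suc (count-below n t t≤n) ⟩
  suc t ∎
  where open ≡-Reasoning

toList-lookup : {A : Set} {k : ℕ} (u : Vec A k) → toList u ≡ List.tabulate (lookup u)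
toList-lookup []      = refl
toList-lookup (x ∷ u) = cong (x ∷_) (toList-lookup u)

lookup-injective : {A : Set} {k : ℕ} (u : Vec A k) → Unique (toList u) →
  ∀ {i j} → lookup u i ≡ lookup u j → i ≡ j
lookup-injective (x ∷ u) (_  ∷ _)  {Fin.zero}  {Fin.zero}  _ = refl
lookup-injective (x ∷ u) (x∉ ∷ _)  {Fin.zero}  {Fin.suc j} e = ⊥-elim (All.lookup x∉ (∈-toList⁺ (∈-lookup j u)) e)
lookup-injective (x ∷ u) (x∉ ∷ _)  {Fin.suc i} {Fin.zero}  e = ⊥-elim (All.lookup x∉ (∈-toList⁺ (∈-lookup i u)) (sym e))
lookup-injective (x ∷ u) (_  ∷ pu) {Fin.suc i} {Fin.suc j} e = cong Fin.suc (lookup-injective u pu e)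

-- Pigeonhole: n distinct elements of Fin n exhaust Fin n.
perm-surjective : ∀ {n} (u : Vec (Fin n) n) → IsPerm u → ∀ y → y ∈ toList u
perm-surjective {suc n} u pu y with DecMembership._∈?_ FinP._≟_ y (toList u)
... | yes y∈u = y∈u
... | no  y∉u = ⊥-elim (ℕP.<-irrefl refl (FinP.injective⇒≤ squeeze-injective))
  where
  avoids : ∀ i → ¬ y ≡ lookup u i
  avoids i refl = y∉u (∈-toList⁺ (∈-lookup i u))
  squeeze-injective : ∀ {i j} → punchOut (avoids i) ≡ punchOut (avoids j) → i ≡ j
  squeeze-injective e = lookup-injective u pu (FinP.punchOut-injective (avoids _) (avoids _) e)

perm-↭ : ∀ {n} (u : Vec (Fin n) n) → IsPerm u → toList u ↭ allFin n
perm-↭ {n} u pu = ∼bag⇒↭ (unique∧set⇒bag pu (UniqueP.allFin⁺ n)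
  (mk⇔ (λ _ → ∈-allFin _) (λ _ → perm-surjective u pu _)))

smaller : ∀ {m k} → Fin m → Vec (Fin m) k → ℕ
smaller x w = count (λ y → toℕ y ℕP.<? toℕ x) (toList w)

inversions : ∀ {m k} → Vec (Fin m) k → ℕ
inversions []      = 0
inversions (x ∷ w) = smaller x w ℕ.+ inversions w

invRow : ∀ {m k} → Vec (Fin m) k → Fin k → ℕ
invRow {k = k} w i = count (λ j → (i Fin.<? j) ×-dec (lookup w j Fin.<? lookup w i)) (allFin k)

invRows : ∀ {m k} → Vec (Fin m) k → ℕ
invRows {k = k} w = sum (map (invRow w) (allFin k))

invRows-∷ : ∀ {m k} (x : Fin m) (w : Vec (Fin m) k) → invRows (x ∷ w) ≡ smaller x w ℕ.+ invRows w
invRows-∷ {k = k} x w = cong₂ ℕ._+_ first-row other-rows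
  where
  first-row : invRow (x ∷ w) Fin.zero ≡ smaller x w
  first-row = begin
    invRow (x ∷ w) Fin.zero
      ≡⟨ count-allFin-suc {k} (λ (j : Fin (suc k)) →
                                  (Fin.zero {k} Fin.<? j) ×-dec (lookup (x ∷ w) j Fin.<? x)) ⟩
    count (λ j → (Fin.zero {k} Fin.<? Fin.suc j) ×-dec (lookup w j Fin.<? x)) (allFin k)
      ≡⟨ count-≐ _ _ proj₂ (λ p → s≤s z≤n , p) (allFin k) ⟩
    count ((λ y → toℕ y ℕP.<? toℕ x) ∘ lookup w) (allFin k)
      ≡⟨ sym (count-map (λ y → toℕ y ℕP.<? toℕ x) (lookup w) (allFin k)) ⟩
    count (λ y → toℕ y ℕP.<? toℕ x) (map (lookup w) (allFin k))
      ≡⟨ cong (count (λ y → toℕ y ℕP.<? toℕ x))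
              (trans (LP.map-tabulate (λ i → i) (lookup w)) (sym (toList-lookup w))) ⟩
    smaller x w ∎
    where open ≡-Reasoning
  shifted-row : ∀ i → invRow (x ∷ w) (Fin.suc i) ≡ invRow w i
  shifted-row i = trans
    (count-allFin-suc {k} (λ (j : Fin (suc k)) → (Fin.suc i Fin.<? j) ×-dec (lookup (x ∷ w) j Fin.<? lookup w i)))
    (count-≐ _ _ (λ { (s≤s i<j , p) → i<j , p }) (λ { (i<j , p) → s≤s i<j , p }) (allFin k))
  other-rows : sum (map (invRow (x ∷ w)) (List.tabulate Fin.suc)) ≡ invRows w
  other-rows = begin
    sum (map (invRow (x ∷ w)) (List.tabulate Fin.suc)) ≡⟨ cong sum (LP.map-tabulate Fin.suc (invRow (x ∷ w))) ⟩
    sum (List.tabulate (invRow (x ∷ w) ∘ Fin.suc))      ≡⟨ cong sum (LP.tabulate-cong shifted-row) ⟩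
    sum (List.tabulate (invRow w))                       ≡⟨ cong sum (sym (LP.map-tabulate (λ i → i) (invRow w))) ⟩
    invRows w ∎
    where open ≡-Reasoning

inv≡inversions : ∀ {n} (w : Vec (Fin n) n) → inv w ≡ inversions w
inv≡inversions {n} w = trans by-rows (rows≡inversions w)
  where
  by-rows : inv w ≡ invRows w
  by-rows = trans (count-concatMap _ (λ i → map (i ,_) (allFin n)) (allFin n))
    (cong sum (LP.map-cong (λ i → count-map _ (i ,_) (allFin n)) (allFin n)))
  rows≡inversions : ∀ {m k} (v : Vec (Fin m) k) → invRows v ≡ inversions v
  rows≡inversions []      = refl
  rows≡inversions (x ∷ v) = trans (invRows-∷ x v) (cong (smaller x v ℕ.+_) (rows≡inversions v))

inversions-map : ∀ {m m' k} (f : Fin m → Fin m') →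
  (∀ {y z} → toℕ y < toℕ z → toℕ (f y) < toℕ (f z)) → (∀ {y z} → toℕ (f y) < toℕ (f z) → toℕ y < toℕ z) →
  (w : Vec (Fin m) k) → inversions (Vec.map f w) ≡ inversions w
inversions-map f mono cancel []      = refl
inversions-map f mono cancel (x ∷ w) = cong₂ ℕ._+_ smaller-map (inversions-map f mono cancel w)
  where
  smaller-map : smaller (f x) (Vec.map f w) ≡ smaller x w
  smaller-map = trans (cong (count _) (VecP.toList-map f w))
    (trans (count-map _ f (toList w)) (count-≐ _ _ cancel mono (toList w)))

-- Writing a in front of punchIn a ∘ u adds exactly a inversions when u is a
-- permutation: the entries below a are the a values 0, …, a - 1.
inv-insert : ∀ {n} (a : Fin (suc n)) (u : Vec (Fin n) n) → IsPerm u →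
  inv (a ∷ Vec.map (punchIn a) u) ≡ toℕ a ℕ.+ inv u
inv-insert {n} a u pu = begin
  inv (a ∷ Vec.map (punchIn a) u)                                  ≡⟨ inv≡inversions (a ∷ Vec.map (punchIn a) u) ⟩
  smaller a (Vec.map (punchIn a) u) ℕ.+ inversions (Vec.map (punchIn a) u)
    ≡⟨ cong₂ ℕ._+_ smaller-a (inversions-map (punchIn a) (punchIn-<-mono a) (punchIn-<-cancel a) u) ⟩
  toℕ a ℕ.+ inversions u                                           ≡⟨ cong (toℕ a ℕ.+_) (sym (inv≡inversions u)) ⟩
  toℕ a ℕ.+ inv u ∎
  where
  open ≡-Reasoning
  below? : ∀ {m} → Decidable (λ (y : Fin m) → toℕ y < toℕ a)
  below? y = toℕ y ℕP.<? toℕ a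
  smaller-a : smaller a (Vec.map (punchIn a) u) ≡ toℕ a
  smaller-a = begin
    count below? (toList (Vec.map (punchIn a) u)) ≡⟨ cong (count below?) (VecP.toList-map (punchIn a) u) ⟩
    count below? (map (punchIn a) (toList u))     ≡⟨ count-map below? (punchIn a) (toList u) ⟩
    count (below? ∘ punchIn a) (toList u)
      ≡⟨ count-≐ _ below? (proj₁ (punchIn-<-⇔ a _)) (proj₂ (punchIn-<-⇔ a _)) (toList u) ⟩
    count below? (toList u)                       ≡⟨ count-↭ below? (perm-↭ u pu) ⟩
    count below? (allFin n)                       ≡⟨ count-below n (toℕ a) (ℕP.≤-pred (FinP.toℕ<n a)) ⟩
    toℕ a ∎

-- Permutations of Fin (n+1) beginning with a and having d inversions correspond,
-- via u ↦ a ∷ punchIn a ∘ u, to permutations of Fin n with a + inv u = d.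
firstEntry-count : ∀ n d (a : Fin (suc n)) →
  count (λ v → isPerm? (a ∷ v) ×-dec (inv (a ∷ v) ℕ.≟ d)) (vecsOver (allFin (suc n)) n)
  ≡ count (λ u → isPerm? u ×-dec (toℕ a ℕ.+ inv u ℕ.≟ d)) (vecsOver (allFin n) n)
firstEntry-count n d a = begin
  count (λ v → isPerm? (a ∷ v) ×-dec (inv (a ∷ v) ℕ.≟ d)) V
    ≡⟨ count-≐ _ (λ v → allEntries? (distinctFrom? a) v ×-dec Q? v)
         (λ { (a∉ ∷ uv , e) → a∉ , uv , e }) (λ { (a∉ , uv , e) → a∉ ∷ uv , e }) V ⟩
  count (λ v → allEntries? (distinctFrom? a) v ×-dec Q? v) V
    ≡⟨ sym (count-filter Q? (allEntries? (distinctFrom? a)) V) ⟩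
  count Q? (filter (allEntries? (distinctFrom? a)) V)
    ≡⟨ cong (count Q?) (vecsOver-filter (distinctFrom? a) (allFin (suc n)) n) ⟩
  count Q? (vecsOver (filter (distinctFrom? a) (allFin (suc n))) n)
    ≡⟨ cong (λ L → count Q? (vecsOver L n)) (allFin-punchIn n a) ⟩
  count Q? (vecsOver (map (punchIn a) (allFin n)) n)
    ≡⟨ cong (count Q?) (vecsOver-map (punchIn a) (allFin n) n) ⟩
  count Q? (map (Vec.map (punchIn a)) (vecsOver (allFin n) n))
    ≡⟨ count-map Q? (Vec.map (punchIn a)) (vecsOver (allFin n) n) ⟩
  count (Q? ∘ Vec.map (punchIn a)) (vecsOver (allFin n) n)
    ≡⟨ count-≐ _ R? (λ { (uu , e) → let pu = unmap uu in pu , trans (sym (inv-insert a _ pu)) e })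
                     (λ { (pu , e) → remap pu , trans (inv-insert a _ pu) e }) (vecsOver (allFin n) n) ⟩
  count R? (vecsOver (allFin n) n) ∎
  where
  open ≡-Reasoning
  V = vecsOver (allFin (suc n)) n
  Q? : Decidable (λ (v : Vec (Fin (suc n)) n) → Unique (toList v) × inv (a ∷ v) ≡ d)
  Q? v = UFin.unique? (toList v) ×-dec (inv (a ∷ v) ℕ.≟ d)
  R? : Decidable (λ (u : Vec (Fin n) n) → IsPerm u × toℕ a ℕ.+ inv u ≡ d)
  R? u = isPerm? u ×-dec (toℕ a ℕ.+ inv u ℕ.≟ d)
  unmap : ∀ {u : Vec (Fin n) n} → Unique (toList (Vec.map (punchIn a) u)) → IsPerm u
  unmap {u} uu = UniqueP.map⁻ (subst Unique (VecP.toList-map (punchIn a) u) uu)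
  remap : ∀ {u : Vec (Fin n) n} → IsPerm u → Unique (toList (Vec.map (punchIn a) u))
  remap {u} pu = subst Unique (sym (VecP.toList-map (punchIn a) u)) (UniqueP.map⁺ (FinP.punchIn-injective a _ _) pu)

count-shift : {A : Set} {P : A → Set} (P? : Decidable P) (f : A → ℕ) (xs : List A) → ∀ t d →
  + count (λ x → P? x ×-dec (t ℕ.+ f x ℕ.≟ d)) xs
  ≡ shift t (λ e → + count (λ x → P? x ×-dec (f x ℕ.≟ e)) xs) d
count-shift P? f xs zero    d       = refl
count-shift P? f xs (suc t) zero    = cong +_ (count-none _ (λ { _ (_ , ()) }) xs)
count-shift P? f xs (suc t) (suc d) = trans
  (cong +_ (count-≐ _ _ (λ { (p , e) → p , ℕP.suc-injective e }) (λ { (p , e) → p , cong suc e }) xs))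
  (count-shift P? f xs t d)

map-allFin-toℕ : {A : Set} (f : ℕ → A) → ∀ k → map (f ∘ toℕ) (allFin k) ≡ applyUpTo f k
map-allFin-toℕ f k = trans (LP.map-tabulate (λ i → i) (f ∘ toℕ)) (tabulate-toℕ f k)
  where
  tabulate-toℕ : {A : Set} (f : ℕ → A) → ∀ k → List.tabulate {n = k} (f ∘ toℕ) ≡ applyUpTo f k
  tabulate-toℕ f zero    = refl
  tabulate-toℕ f (suc k) = cong (f 0 ∷_) (tabulate-toℕ (f ∘ suc) k)

perms : ℕ → Seq
perms n d = + numPermsWithInv n d

perms-rec : ∀ n → perms (suc n) ≗ window (suc n) (perms n)
perms-rec n d = begin
  + count P? (concatMap (λ a → map (a ∷_) V) (allFin (suc n)))
    ≡⟨ cong +_ (count-concatMap P? (λ a → map (a ∷_) V) (allFin (suc n))) ⟩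
  + sum (map (λ a → count P? (map (a ∷_) V)) (allFin (suc n)))
    ≡⟨ sumℤ-cast (λ a → count P? (map (a ∷_) V)) (allFin (suc n)) ⟩
  sumℤ (map (λ a → + count P? (map (a ∷_) V)) (allFin (suc n)))
    ≡⟨ sumℤ-cong _ _ first-entry (allFin (suc n)) ⟩
  sumℤ (map ((λ t → shift t (perms n) d) ∘ toℕ) (allFin (suc n)))
    ≡⟨ cong sumℤ (map-allFin-toℕ (λ t → shift t (perms n) d) (suc n)) ⟩
  window (suc n) (perms n) d ∎
  where
  open ≡-Reasoning
  V = vecsOver (allFin (suc n)) n
  P? : Decidable (λ (w : Vec (Fin (suc n)) (suc n)) → IsPerm w × inv w ≡ d)
  P? w = isPerm? w ×-dec (inv w ℕ.≟ d)
  first-entry : ∀ a → + count P? (map (a ∷_) V) ≡ shift (toℕ a) (perms n) d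
  first-entry a = trans (cong +_ (trans (count-map P? (a ∷_) V) (firstEntry-count n d a)))
    (count-shift isPerm? inv (vecsOver (allFin n) n) (toℕ a) d)

perms-1 : perms 1 ≗ binomTerm 0
perms-1 zero    = refl
perms-1 (suc d) = sym (binomTerm-unit d)

-- Reindexing the partitions of the theorem by their parts larger than 1.

-- The subsets of {2, …, k+1}, each listed in decreasing order.
subsets : ℕ → List (List ℕ)
subsets zero    = [] ∷ []
subsets (suc k) = subsets k ++ map (suc (suc k) ∷_) (subsets k)

sign : List ℕ → ℤ
sign S = -1ℤ ℤ.^ length S

IsSubset : ℕ → List ℕ → Set
IsSubset k S = AllPairs _>_ S × All (λ x → 1 < x × x ≤ suc k) S

subsets-sound : ∀ k {S} → S ∈ subsets k → IsSubset k S
subsets-sound zero    (here refl) = [] , []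
subsets-sound (suc k) S∈ with ∈-++⁻ (subsets k) S∈
... | inj₁ S∈ₖ = let (dec , range) = subsets-sound k S∈ₖ in
  dec , All.map (λ (1<x , x≤) → 1<x , ℕP.m≤n⇒m≤1+n x≤) range
... | inj₂ S∈ₘ with ∈-map⁻ (suc (suc k) ∷_) S∈ₘ
...   | S' , S'∈ , refl = let (dec , range) = subsets-sound k S'∈ in
  All.map (λ (_ , x≤) → s≤s x≤) range ∷ dec ,
  (s≤s (s≤s z≤n) , ℕP.≤-refl) ∷ All.map (λ (1<x , x≤) → 1<x , ℕP.m≤n⇒m≤1+n x≤) range

subsets-complete : ∀ k S → IsSubset k S → S ∈ subsets k
subsets-complete zero    []      _                         = here refl
subsets-complete zero    (x ∷ S) (_ , (1<x , x≤1) ∷ _)     = ⊥-elim (ℕP.<⇒≱ 1<x x≤1)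
subsets-complete (suc k) []      _                         = ∈-++⁺ˡ (subsets-complete k [] ([] , []))
subsets-complete (suc k) (x ∷ S) (x>S ∷ dec , (1<x , x≤) ∷ range) with x ℕP.≟ suc (suc k)
... | yes refl = ∈-++⁺ʳ (subsets k) (∈-map⁺ (suc (suc k) ∷_) (subsets-complete k S (dec , range′)))
  where range′ = All.zipWith (λ (x>y , 1<y , _) → 1<y , ℕP.≤-pred x>y) (x>S , range)
... | no x≢ = ∈-++⁺ˡ (subsets-complete k (x ∷ S) (x>S ∷ dec , (1<x , x≤′) ∷ range′))
  where
  x≤′ = ℕP.≤-pred (ℕP.≤∧≢⇒< x≤ x≢)
  range′ = All.zipWith (λ (x>y , 1<y , _) → 1<y , ℕP.≤-trans (ℕP.<⇒≤ x>y) x≤′) (x>S , range)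

subsets-unique : ∀ k → Unique (subsets k)
subsets-unique zero    = [] ∷ []
subsets-unique (suc k) =
  UniqueP.++⁺ (subsets-unique k) (UniqueP.map⁺ (λ { refl → refl }) (subsets-unique k)) disjoint
  where
  -- the new subsets contain k+2, the old ones do not
  disjoint : ∀ {S} → ¬ (S ∈ subsets k × S ∈ map (suc (suc k) ∷_) (subsets k))
  disjoint (S∈ₖ , S∈ₘ) with ∈-map⁻ (suc (suc k) ∷_) S∈ₘ
  ... | _ , _ , refl with proj₂ (subsets-sound k S∈ₖ)
  ...   | (_ , k+2≤k+1) ∷ _ = ℕP.<-irrefl refl k+2≤k+1

qprod-expand : ∀ k X d → qprod k X d ≡ sumℤ (map (λ S → sign S * shift (sum S) X d) (subsets k))
qprod-expand zero    X d = solve 1 (λ x → x := con (+ 1) :* x :+ con (+ 0)) refl (X d)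
qprod-expand (suc k) X d = begin
  qprod k X d - shift m (qprod k X) d
    ≡⟨ cong₂ _-_ (qprod-expand k X d) (shift-cong m (λ e → qprod-expand k X e) d) ⟩
  Σ F (subsets k) - shift m (λ e → Σ (λ S → sign S * shift (sum S) X e) (subsets k)) d
    ≡⟨ cong (_-_ (Σ F (subsets k))) (shift-Σ sign (λ S → shift (sum S) X) (subsets k) m d) ⟩
  Σ F (subsets k) - Σ (λ S → sign S * shift m (shift (sum S) X) d) (subsets k)
    ≡⟨ cong (_+_ (Σ F (subsets k))) (sym (sumℤ-neg _ (subsets k))) ⟩
  Σ F (subsets k) + Σ (λ S → - (sign S * shift m (shift (sum S) X) d)) (subsets k)
    ≡⟨ cong (_+_ (Σ F (subsets k))) (sumℤ-cong _ _ new-term (subsets k)) ⟩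
  Σ F (subsets k) + Σ (F ∘ (m ∷_)) (subsets k)
    ≡⟨ cong (_+_ (Σ F (subsets k))) (cong sumℤ (LP.map-∘ (subsets k))) ⟩
  Σ F (subsets k) + Σ F (map (m ∷_) (subsets k))
    ≡⟨ sym (trans (cong sumℤ (LP.map-++ F (subsets k) _)) (sumℤ-++ (map F (subsets k)) _)) ⟩
  Σ F (subsets (suc k)) ∎
  where
  open ≡-Reasoning
  m = suc (suc k)
  Σ : (List ℕ → ℤ) → List (List ℕ) → ℤ
  Σ g Ss = sumℤ (map g Ss)
  F : List ℕ → ℤ
  F S = sign S * shift (sum S) X d
  new-term : ∀ S → - (sign S * shift m (shift (sum S) X) d) ≡ F (m ∷ S)
  new-term S = begin
    - (sign S * shift m (shift (sum S) X) d) ≡⟨ cong (λ z → - (sign S * z)) (sym (shift-+ m (sum S) X d)) ⟩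
    - (sign S * shift (m ℕ.+ sum S) X d)     ≡⟨ ℤP.neg-distribˡ-* (sign S) _ ⟩
    - sign S * shift (m ℕ.+ sum S) X d       ≡⟨ cong (_* shift (m ℕ.+ sum S) X d) (sym (ℤP.-1*i≡-i (sign S))) ⟩
    F (m ∷ S) ∎

bigParts-withOnes : ∀ S m → All (1 <_) S → bigParts (S ++ replicate m 1) ≡ S
bigParts-withOnes S m big = begin
  bigParts (S ++ replicate m 1)
    ≡⟨ LP.filter-++ (1 ℕP.<?_) S (replicate m 1) ⟩
  bigParts S ++ bigParts (replicate m 1)
    ≡⟨ cong₂ _++_ (LP.filter-all (1 ℕP.<?_) big)
                  (LP.filter-none (1 ℕP.<?_) (AllP.replicate⁺ m (ℕP.<-irrefl refl))) ⟩
  S ++ []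
    ≡⟨ LP.++-identityʳ S ⟩
  S ∎
  where open ≡-Reasoning

m₁-withOnes : ∀ S m → All (1 <_) S → m₁ (S ++ replicate m 1) ≡ m
m₁-withOnes S m big = begin
  length (filter (ℕ._≟ 1) (S ++ replicate m 1))
    ≡⟨ cong length (LP.filter-++ (ℕ._≟ 1) S (replicate m 1)) ⟩
  length (filter (ℕ._≟ 1) S ++ filter (ℕ._≟ 1) (replicate m 1))
    ≡⟨ cong length (cong₂ _++_ (LP.filter-none (ℕ._≟ 1) (All.map (λ 1<x x≡1 → ℕP.<-irrefl (sym x≡1) 1<x) big))
                               (LP.filter-all (ℕ._≟ 1) (AllP.replicate⁺ m refl))) ⟩
  length (replicate m 1)
    ≡⟨ LP.length-replicate m ⟩
  m ∎
  where open ≡-Reasoning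

sum-withOnes : ∀ S m → sum (S ++ replicate m 1) ≡ sum S ℕ.+ m
sum-withOnes S m = trans (SumP.sum-++ S (replicate m 1)) (cong (sum S ℕ.+_) (sum-ones m))
  where
  sum-ones : ∀ m → sum (replicate m 1) ≡ m
  sum-ones zero    = refl
  sum-ones (suc m) = cong suc (sum-ones m)

term-withOnes : ∀ k S m → All (1 <_) S → term (suc k) (S ++ replicate m 1) ≡ sign S * binomTerm k m
term-withOnes k S m big = cong₂ (λ B o → sign B * binomTerm k o) (bigParts-withOnes S m big) (m₁-withOnes S m big)

withOnes-decreasing : ∀ S m → AllPairs _>_ S → All (1 <_) S → Linked _≥_ (S ++ replicate m 1)
withOnes-decreasing []          m       _                  _         = ones m
  where
  ones : ∀ m → Linked _≥_ (replicate m 1)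
  ones zero          = []
  ones (suc zero)    = [-]
  ones (suc (suc m)) = ℕP.≤-refl ∷ ones (suc m)
withOnes-decreasing (x ∷ [])    zero    _                  _         = [-]
withOnes-decreasing (x ∷ [])    (suc m) _                  (1<x ∷ _) =
  ℕP.<⇒≤ 1<x ∷ withOnes-decreasing [] (suc m) [] []
withOnes-decreasing (x ∷ y ∷ S) m       ((x>y ∷ _) ∷ dec) (_ ∷ big) =
  ℕP.<⇒≤ x>y ∷ withOnes-decreasing (y ∷ S) m dec big

μ₁-withOnes : ∀ k S m → All (λ x → 1 < x × x ≤ suc k) S → μ₁ (S ++ replicate m 1) ≤ suc k
μ₁-withOnes k []      zero    _              = z≤n
μ₁-withOnes k []      (suc m) _              = s≤s z≤n
μ₁-withOnes k (x ∷ S) m       ((_ , x≤) ∷ _) = x≤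

fill : ℕ → List ℕ → List ℕ
fill d S = S ++ replicate (d ∸ sum S) 1

canonical : ℕ → ℕ → List (List ℕ)
canonical k d = map (fill d) (filter (λ S → sum S ℕP.≤? d) (subsets k))

canonical-sum : ∀ k d → sumℤ (map (term (suc k)) (canonical k d))
                      ≡ sumℤ (map (λ S → sign S * shift (sum S) (binomTerm k) d) (subsets k))
canonical-sum k d = trans (cong sumℤ (sym (LP.map-∘ (filter (λ S → sum S ℕP.≤? d) (subsets k)))))
  (sumℤ-filter (λ S → sum S ℕP.≤? d) _ _ (subsets k)
    (λ {S} S∈ ΣS≤d → trans (term-withOnes k S (d ∸ sum S) (big S∈))
                           (cong (sign S *_) (sym (shift-≤ (sum S) (binomTerm k) ΣS≤d))))
    (λ {S} _ ΣS≰d → trans (cong (sign S *_) (shift-> (sum S) (binomTerm k) (ℕP.≰⇒> ΣS≰d)))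
                          (ℤP.*-zeroʳ (sign S))))
  where
  big : ∀ {S} → S ∈ subsets k → All (1 <_) S
  big S∈ = All.map proj₁ (proj₂ (subsets-sound k S∈))

vecsOver-unique : {A : Set} {L : List A} → Unique L → ∀ k → Unique (vecsOver L k)
vecsOver-unique uL zero            = [] ∷ []
vecsOver-unique {L = L} uL (suc k) = unique-concatMap (λ b → map (b ∷_) (vecsOver L k)) uL
  (λ b → UniqueP.map⁺ VecP.∷-injectiveʳ (vecsOver-unique uL k)) same-head
  where
  same-head : ∀ {a b v} → v ∈ map (a ∷_) (vecsOver L k) → v ∈ map (b ∷_) (vecsOver L k) → a ≡ b
  same-head v∈a v∈b with _ , _ , refl ← ∈-map⁻ _ v∈a | _ , _ , e ← ∈-map⁻ _ v∈b = VecP.∷-injectiveˡ e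

-- The candidate lists are pairwise distinct: distinct lengths lie in distinct blocks.
candidates-unique : ∀ d → Unique (candidates d)
candidates-unique d = unique-concatMap _ (UniqueP.upTo⁺ (suc d))
  (λ k → UniqueP.map⁺ toList-injective (vecsOver-unique (UniqueP.map⁺ ℕP.suc-injective (UniqueP.upTo⁺ d)) k))
  same-length
  where
  toList-injective : ∀ {k} {v w : Vec ℕ k} → toList v ≡ toList w → v ≡ w
  toList-injective {v = v} {w} e = trans (sym (VecP.cast-is-id refl v)) (VecP.toList-injective refl v w e)
  length-in-block : ∀ {k μ} → μ ∈ map toList (vecsOver (map suc (upTo d)) k) → length μ ≡ k
  length-in-block μ∈ with v , _ , refl ← ∈-map⁻ toList μ∈ = VecP.length-toList v
  same-length : ∀ {k l μ} → μ ∈ map toList (vecsOver (map suc (upTo d)) k) →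
                μ ∈ map toList (vecsOver (map suc (upTo d)) l) → k ≡ l
  same-length μ∈k μ∈l = trans (sym (length-in-block μ∈k)) (length-in-block μ∈l)

-- Distinct subsets give distinct partitions, since fill d S determines S.
canonical-unique : ∀ k d → Unique (canonical k d)
canonical-unique k d = unique-map-on (fill d) (UniqueP.filter⁺ _ (subsets-unique k)) fill-injective
  where
  fill-injective : ∀ {S T} → S ∈ filter (λ S → sum S ℕP.≤? d) (subsets k) →
    T ∈ filter (λ S → sum S ℕP.≤? d) (subsets k) → fill d S ≡ fill d T → S ≡ T
  fill-injective {S} {T} S∈ T∈ e =
    trans (sym (bigParts-withOnes S _ (big S∈))) (trans (cong bigParts e) (bigParts-withOnes T _ (big T∈)))
    where
    big : ∀ {U} → U ∈ filter (λ S → sum S ℕP.≤? d) (subsets k) → All (1 <_) U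
    big U∈ = All.map proj₁ (proj₂ (subsets-sound k (proj₁ (∈-filter⁻ _ {xs = subsets k} U∈))))

candidates-complete : ∀ d μ → length μ ≤ d → All (λ x → 1 ≤ x × x ≤ d) μ → μ ∈ candidates d
candidates-complete d μ len≤d entries =
  ∈-concatMap⁺ (λ k → map toList (vecsOver alphabet k))
    (Any.map (λ { refl → subst (_∈ map toList (vecsOver alphabet (length μ))) (VecP.toList∘fromList μ)
                                 (∈-map⁺ toList (vecsOver-complete μ (All.map in-alphabet entries))) })
             (∈-upTo⁺ (s≤s len≤d)))
  where
  alphabet = map suc (upTo d)
  in-alphabet : ∀ {x} → 1 ≤ x × x ≤ d → x ∈ alphabet
  in-alphabet {suc x} (_ , x<d) = ∈-map⁺ suc (∈-upTo⁺ x<d)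
  vecsOver-complete : {A : Set} {L : List A} (ν : List A) → All (_∈ L) ν → fromList ν ∈ vecsOver L (length ν)
  vecsOver-complete []      []           = here refl
  vecsOver-complete {L = L} (x ∷ ν) (x∈L ∷ ν⊆L) = ∈-concatMap⁺ (λ b → map (b ∷_) (vecsOver L (length ν)))
    (Any.map (λ { refl → ∈-map⁺ (x ∷_) (vecsOver-complete ν ν⊆L) }) x∈L)

length≤sum : ∀ μ → All (1 ≤_) μ → length μ ≤ sum μ
length≤sum []      []          = z≤n
length≤sum (x ∷ μ) (1≤x ∷ pos) = ℕP.+-mono-≤ 1≤x (length≤sum μ pos)

part≤sum : ∀ μ → All (_≤ sum μ) μ
part≤sum []      = []
part≤sum (x ∷ μ) = ℕP.m≤m+n x (sum μ) ∷ All.map (λ y≤ → ℕP.≤-trans y≤ (ℕP.m≤n+m (sum μ) x)) (part≤sum μ)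

fill-inRange : ∀ k d {S} → S ∈ subsets k → sum S ≤ d → InRange (suc k) d (fill d S)
fill-inRange k d {S} S∈ ΣS≤d =
  (withOnes-decreasing S m dec big , positive , sum-fill) , μ₁-withOnes k S m range , distinct
  where
  m = d ∸ sum S
  dec = proj₁ (subsets-sound k S∈)
  range = proj₂ (subsets-sound k S∈)
  big = All.map proj₁ range
  positive : All (1 ≤_) (fill d S)
  positive = AllP.++⁺ (All.map ℕP.<⇒≤ big) (AllP.replicate⁺ m ℕP.≤-refl)
  sum-fill : sum (fill d S) ≡ d
  sum-fill = trans (sum-withOnes S m) (ℕP.m+[n∸m]≡n ΣS≤d)
  distinct : Uℕ.Unique (bigParts (fill d S))
  distinct = subst Uℕ.Unique (sym (bigParts-withOnes S m big))
                   (AllPairs.map (λ x>y x≡y → ℕP.<-irrefl (sym x≡y) x>y) dec)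

canonical⊆range : ∀ k d {μ} → μ ∈ canonical k d → μ ∈ filter (inRange? (suc k) d) (candidates d)
canonical⊆range k d μ∈ with S , S∈ , refl ← ∈-map⁻ (fill d) μ∈ =
  ∈-filter⁺ (inRange? (suc k) d) (candidates-complete d (fill d S) short bounded) inRange
  where
  S∈ₖ = proj₁ (∈-filter⁻ (λ S → sum S ℕP.≤? d) {xs = subsets k} S∈)
  inRange = fill-inRange k d S∈ₖ (proj₂ (∈-filter⁻ (λ S → sum S ℕP.≤? d) {xs = subsets k} S∈))
  positive = proj₁ (proj₂ (proj₁ inRange))
  sum-fill = proj₂ (proj₂ (proj₁ inRange))
  short = subst (length (fill d S) ≤_) sum-fill (length≤sum (fill d S) positive)
  bounded = All.zipWith (λ (1≤x , x≤) → 1≤x , subst (_ ≤_) sum-fill x≤) (positive , part≤sum (fill d S))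

decreasing-pairs : ∀ {μ} → Linked _≥_ μ → AllPairs _≥_ μ
decreasing-pairs = LinkedP.Linked⇒AllPairs (λ x≥y y≥z → ℕP.≤-trans y≥z x≥y)

parts≤μ₁ : ∀ μ → Linked _≥_ μ → All (_≤ μ₁ μ) μ
parts≤μ₁ []      _   = []
parts≤μ₁ (x ∷ μ) dec = ℕP.≤-refl ∷ AllPairs.head (decreasing-pairs dec)

decompose : ∀ μ → Linked _≥_ μ → All (1 ≤_) μ → μ ≡ bigParts μ ++ replicate (m₁ μ) 1
decompose []                  _   _          = refl
decompose (1 ∷ μ)             lin (_ ∷ pos)  =
  trans (cong (1 ∷_) (trans (decompose μ (Linked.tail lin) pos) (cong (_++ ones) no-big)))
        (cong (_++ 1 ∷ ones) (sym no-big))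
  where
  ones = replicate (m₁ μ) 1
  -- every later part is at most 1
  no-big : bigParts μ ≡ []
  no-big = LP.filter-none (1 ℕP.<?_) (All.map ℕP.≤⇒≯ (AllPairs.head (decreasing-pairs lin)))
decompose (suc (suc x) ∷ μ)   lin (_ ∷ pos)  = cong (suc (suc x) ∷_) (decompose μ (Linked.tail lin) pos)

range⊆canonical : ∀ k d {μ} → μ ∈ filter (inRange? (suc k) d) (candidates d) → μ ∈ canonical k d
range⊆canonical k d {μ} μ∈ = subst (_∈ canonical k d) fill-S≡μ
  (∈-map⁺ (fill d) (∈-filter⁺ (λ S → sum S ℕP.≤? d) S∈ ΣS≤d))
  where
  inRange = proj₂ (∈-filter⁻ (inRange? (suc k) d) {xs = candidates d} μ∈)
  dec = proj₁ (proj₁ inRange)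
  positive = proj₁ (proj₂ (proj₁ inRange))
  sum-μ = proj₂ (proj₂ (proj₁ inRange))
  μ₁≤ = proj₁ (proj₂ inRange)
  distinct = proj₂ (proj₂ inRange)
  S = bigParts μ
  m = m₁ μ
  μ≡ : μ ≡ S ++ replicate m 1
  μ≡ = decompose μ dec positive
  ΣS+m≡d : sum S ℕ.+ m ≡ d
  ΣS+m≡d = trans (sym (sum-withOnes S m)) (trans (cong sum (sym μ≡)) sum-μ)
  ΣS≤d : sum S ≤ d
  ΣS≤d = subst (sum S ≤_) ΣS+m≡d (ℕP.m≤m+n (sum S) m)
  fill-S≡μ : fill d S ≡ μ
  fill-S≡μ = trans (cong (λ z → S ++ replicate z 1) (trans (cong (_∸ sum S) (sym ΣS+m≡d)) (ℕP.m+n∸m≡n (sum S) m)))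
                   (sym μ≡)
  S∈ : S ∈ subsets k
  S∈ = subsets-complete k S
    ( AllPairs.zipWith (λ (x≥y , x≢y) → ℕP.≤∧≢⇒< x≥y (x≢y ∘ sym))
        (AllPairsP.filter⁺ (1 ℕP.<?_) (decreasing-pairs dec) , distinct)
    , All.zipWith (λ (1<x , x≤) → 1<x , x≤)
        (AllP.all-filter (1 ℕP.<?_) μ ,
         AllP.filter⁺ (1 ℕP.<?_) (All.map (λ x≤ → ℕP.≤-trans x≤ μ₁≤) (parts≤μ₁ μ dec))))

range↭canonical : ∀ k d → filter (inRange? (suc k) d) (candidates d) ↭ canonical k d
range↭canonical k d = ∼bag⇒↭ (unique∧set⇒bag
  (UniqueP.filter⁺ (inRange? (suc k) d) (candidates-unique d)) (canonical-unique k d)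
  (mk⇔ (range⊆canonical k d) (canonical⊆range k d)))

rhs-expand : ∀ k d → rhs (suc k) d ≡ qprod k (binomTerm k) d
rhs-expand k d = begin
  rhs (suc k) d
    ≡⟨ sumℤ-↭ (↭P.map⁺ (term (suc k)) (range↭canonical k d)) ⟩
  sumℤ (map (term (suc k)) (canonical k d))
    ≡⟨ canonical-sum k d ⟩
  sumℤ (map (λ S → sign S * shift (sum S) (binomTerm k) d) (subsets k))
    ≡⟨ sym (qprod-expand k (binomTerm k) d) ⟩
  qprod k (binomTerm k) d ∎
  where open ≡-Reasoning

corollary3p3 : (d n : ℕ) → 1 ≤ d → 1 ≤ n →
    + numPermsWithInv n d ≡ rhs n d
corollary3p3 d zero    _ ()
corollary3p3 d (suc k) _ _ = begin
  perms (suc k) d          ≡⟨ window-recurrence (perms ∘ suc) perms-1 (perms-rec ∘ suc) k d ⟩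
  qprod k (binomTerm k) d  ≡⟨ sym (rhs-expand k d) ⟩
  rhs (suc k) d ∎
  where open ≡-Reasoning
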